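{- Let $X=(p,x)$, $Y=(q,y)$, $X_1,\dots,X_k$, $Y_1,\dots,Y_m$ be mutually independent weighted Bernoulli random variables, with $Y_i=(r_i,y_i)$. Suppose $x\ge y$, $y\ge y_i$ for all $i$, and $$\mathbb{E}(\max(X,X_1,\dots,X_k))\ge\mathbb{E}(\max(Y,X_1,\dots,X_k)).$$ Then $$\mathbb{E}(\max(X,X_1,\dots,X_k,Y_1,\dots,Y_m))\ge\mathbb{E}(\max(Y,X_1,\dots,X_k,Y_1,\dots,Y_m)).$$
   Context: A weighted Bernoulli random variable $(p,x)$ takes the value $x\ge0$ with probability $p$ and $0$ otherwise.
   Formalization: The probabilities and values of all the weighted Bernoulli random variables, including $X$, $Y$ and every $Y_i$, are rational. -}

module Defs where

open import Data.Rational using (ℚ; 0ℚ; 1ℚ; _+_; _*_; _-_; _⊔_; _≤_)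
open import Data.Product using (_×_; _,_; proj₁; proj₂)
open import Data.List using (List; []; _∷_)

-- A weighted Bernoulli random variable (p , x): value x with probability p, else 0.
WBern : Set
WBern = ℚ × ℚ

IsWB : WBern → Set
IsWB (p , x) = (0ℚ ≤ p) × (p ≤ 1ℚ) × (0ℚ ≤ x)

-- Expectation of max(acc, Z₁, …, Zₙ) for mutually independent weighted
-- Bernoulli variables Zᵢ: literally the sum over all 2ⁿ outcomes of
-- (product of outcome probabilities) × (max of realised values).
EmaxFrom : ℚ → List WBern → ℚ
EmaxFrom acc [] = acc
EmaxFrom acc ((p , x) ∷ zs) =
  p * EmaxFrom (acc ⊔ x) zs + (1ℚ - p) * EmaxFrom acc zs

-- 𝔼(max(Z₁,…,Zₙ)) (max of the empty family taken as 0; all values are ≥ 0).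
Emax : List WBern → ℚ
Emax = EmaxFrom 0ℚ

{-# OPTIONS --safe #-}
module Submission where

-- Write f(a) for the expected maximum of the Xᵢ together with a constant a.
-- For accumulators a ∈ [0, y] the hypothesis
--   p f(x) + (1 - p) f(0) ≥ q f(y) + (1 - q) f(0)
-- survives replacing f(0) by f(a): if p ≥ q this is the monotonicity of f
-- alone, and if p ≤ q the fallback f(a) carries the larger weight 1 - p.
-- Since the order of independent variables is irrelevant, we may condition
-- on an appended Yⱼ first; as its value is at most y, this only moves the
-- accumulator within [0, y], so the strengthened comparison persists as the
-- Yⱼ are added one at a time.

open import Defs
open import Data.Rational using (ℚ; 0ℚ; 1ℚ; _+_; _*_; _-_; -_; _⊔_; _≤_; _≥_)
open import Data.Rational.Base using (nonNegative)
open import Data.Rational.Properties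
  using ( ≤-refl; ≤-trans; ≤-total; +-mono-≤; +-monoʳ-≤; +-monoˡ-≤; +-inverseʳ; neg-antimono-≤
        ; *-monoˡ-≤-nonNeg; *-monoʳ-≤-nonNeg; p≤q⇒p⊔q≡q; ⊔-monoˡ-≤; ⊔-lub; p≤q⇒p≤q⊔r
        ; ⊔-commutativeSemigroup; module ≤-Reasoning )
open import Data.Rational.Solver using (module +-*-Solver)
open import Algebra.Properties.CommutativeSemigroup ⊔-commutativeSemigroup using (xy∙z≈xz∙y)
open import Data.Product using (_,_; proj₂)
open import Data.Sum using (inj₁; inj₂)
open import Data.List using (List; []; _∷_; _++_)
open import Data.List.Properties using (++-identityʳ)
open import Data.List.Relation.Unary.All using (All; _∷_)
open import Relation.Binary.PropositionalEquality using (_≡_; refl; sym; cong; cong₂; subst; subst₂; module ≡-Reasoning)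

open +-*-Solver using (solve; _:+_; _:*_; _:-_; _:=_; con)

p≤q⇒0≤q-p : ∀ {p q} → p ≤ q → 0ℚ ≤ q - p
p≤q⇒0≤q-p {p} {q} p≤q = subst (_≤ q - p) (+-inverseʳ p) (+-monoˡ-≤ (- p) p≤q)

mix : ℚ → ℚ → ℚ → ℚ
mix r u v = r * u + (1ℚ - r) * v

mix-mono-≤ : ∀ {r u u′ v v′} → 0ℚ ≤ r → r ≤ 1ℚ → u ≤ u′ → v ≤ v′ → mix r u v ≤ mix r u′ v′
mix-mono-≤ {r} 0≤r r≤1 u≤u′ v≤v′ =
  +-mono-≤ (*-monoˡ-≤-nonNeg r {{nonNegative 0≤r}} u≤u′)
           (*-monoˡ-≤-nonNeg (1ℚ - r) {{nonNegative (p≤q⇒0≤q-p r≤1)}} v≤v′)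

mix-interchange : ∀ r s a b c d → mix r (mix s a b) (mix s c d) ≡ mix s (mix r a c) (mix r b d)
mix-interchange = solve 6 (λ r s a b c d →
  r :* (s :* a :+ (con 1ℚ :- s) :* b) :+ (con 1ℚ :- r) :* (s :* c :+ (con 1ℚ :- s) :* d)
  := s :* (r :* a :+ (con 1ℚ :- r) :* c) :+ (con 1ℚ :- s) :* (r :* b :+ (con 1ℚ :- r) :* d)) refl

mix≡fallback+weighted-gap : ∀ r u v → mix r u v ≡ v + r * (u - v)
mix≡fallback+weighted-gap = solve 3 (λ r u v →
  r :* u :+ (con 1ℚ :- r) :* v := v :+ r :* (u :- v)) refl

mix-change-fallback : ∀ r u v w → mix r u v ≡ mix r u w + (1ℚ - r) * (v - w)
mix-change-fallback = solve 4 (λ r u v w →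
  r :* u :+ (con 1ℚ :- r) :* v := r :* u :+ (con 1ℚ :- r) :* w :+ (con 1ℚ :- r) :* (v :- w)) refl

mix-mono-weight : ∀ {r s u v} → v ≤ u → r ≤ s → mix r u v ≤ mix s u v
mix-mono-weight {r} {s} {u} {v} v≤u r≤s = begin
  mix r u v      ≡⟨ mix≡fallback+weighted-gap r u v ⟩
  v + r * (u - v) ≤⟨ +-monoʳ-≤ v (*-monoʳ-≤-nonNeg (u - v) {{nonNegative (p≤q⇒0≤q-p v≤u)}} r≤s) ⟩
  v + s * (u - v) ≡⟨ sym (mix≡fallback+weighted-gap s u v) ⟩
  mix s u v      ∎
  where open ≤-Reasoning

mix-≤-raise-fallback : ∀ {p q a b z n} → 0ℚ ≤ q → q ≤ 1ℚ → z ≤ n → n ≤ a → b ≤ a →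
  mix q b z ≤ mix p a z → mix q b n ≤ mix p a n
mix-≤-raise-fallback {p} {q} {a} {b} {z} {n} 0≤q q≤1 z≤n n≤a b≤a hyp with ≤-total p q
... | inj₁ p≤q = begin
  mix q b n                       ≡⟨ mix-change-fallback q b n z ⟩
  mix q b z + (1ℚ - q) * (n - z) ≤⟨ +-mono-≤ hyp (*-monoʳ-≤-nonNeg (n - z) {{nonNegative (p≤q⇒0≤q-p z≤n)}}
                                                     (+-monoʳ-≤ 1ℚ (neg-antimono-≤ p≤q))) ⟩
  mix p a z + (1ℚ - p) * (n - z) ≡⟨ sym (mix-change-fallback p a n z) ⟩
  mix p a n                       ∎
  where open ≤-Reasoning
... | inj₂ q≤p = begin
  mix q b n ≤⟨ mix-mono-≤ 0≤q q≤1 b≤a (≤-refl {n}) ⟩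
  mix q a n ≤⟨ mix-mono-weight n≤a q≤p ⟩
  mix p a n ∎
  where open ≤-Reasoning

EmaxFrom-mono-≤ : ∀ (L : List WBern) {a b} → All IsWB L → a ≤ b → EmaxFrom a L ≤ EmaxFrom b L
EmaxFrom-mono-≤ []            _                         a≤b = a≤b
EmaxFrom-mono-≤ ((p , x) ∷ L) ((0≤p , p≤1 , _) ∷ wf-L) a≤b =
  mix-mono-≤ 0≤p p≤1 (EmaxFrom-mono-≤ L wf-L (⊔-monoˡ-≤ x a≤b)) (EmaxFrom-mono-≤ L wf-L a≤b)

EmaxFrom-∷-≤ : ∀ {a x} p (L : List WBern) → a ≤ x →
  EmaxFrom a ((p , x) ∷ L) ≡ mix p (EmaxFrom x L) (EmaxFrom a L)
EmaxFrom-∷-≤ {a} p L a≤x = cong (λ t → mix p (EmaxFrom t L) (EmaxFrom a L)) (p≤q⇒p⊔q≡q a≤x)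

EmaxFrom-++-∷ : ∀ a (A : List WBern) z Ys → EmaxFrom a (A ++ z ∷ Ys) ≡ EmaxFrom a (z ∷ A ++ Ys)
EmaxFrom-++-∷ a []            z       Ys = refl
EmaxFrom-++-∷ a ((s , v) ∷ A) (r , w) Ys = begin
  mix s (EmaxFrom (a ⊔ v) (A ++ (r , w) ∷ Ys)) (EmaxFrom a (A ++ (r , w) ∷ Ys))
    ≡⟨ cong₂ (mix s) (EmaxFrom-++-∷ (a ⊔ v) A (r , w) Ys) (EmaxFrom-++-∷ a A (r , w) Ys) ⟩
  mix s (mix r (E ((a ⊔ v) ⊔ w)) (E (a ⊔ v))) (mix r (E (a ⊔ w)) (E a))
    ≡⟨ mix-interchange s r _ _ _ _ ⟩
  mix r (mix s (E ((a ⊔ v) ⊔ w)) (E (a ⊔ w))) (mix s (E (a ⊔ v)) (E a))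
    ≡⟨ cong (λ t → mix r (mix s (E t) (E (a ⊔ w))) (mix s (E (a ⊔ v)) (E a))) (xy∙z≈xz∙y a v w) ⟩
  mix r (mix s (E ((a ⊔ w) ⊔ v)) (E (a ⊔ w))) (mix s (E (a ⊔ v)) (E a))
    ∎
  where
  open ≡-Reasoning
  E : ℚ → ℚ
  E b = EmaxFrom b (A ++ Ys)

DominatedOn : ℚ → ℚ → List WBern → List WBern → Set
DominatedOn lo hi A B = ∀ n → lo ≤ n → n ≤ hi → EmaxFrom n A ≤ EmaxFrom n B

dominatedOn-++ʳ : ∀ {lo hi} (A B Ys : List WBern) → All IsWB Ys → All (λ b → proj₂ b ≤ hi) Ys →
  DominatedOn lo hi A B → DominatedOn lo hi (A ++ Ys) (B ++ Ys)
dominatedOn-++ʳ A B [] _ _ A≼B rewrite ++-identityʳ A | ++-identityʳ B = A≼B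
dominatedOn-++ʳ A B ((r , w) ∷ Ys) ((0≤r , r≤1 , _) ∷ wf-Ys) (w≤hi ∷ Ys≤hi) A≼B n lo≤n n≤hi = begin
  EmaxFrom n (A ++ (r , w) ∷ Ys)  ≡⟨ EmaxFrom-++-∷ n A (r , w) Ys ⟩
  EmaxFrom n ((r , w) ∷ A ++ Ys)  ≤⟨ mix-mono-≤ 0≤r r≤1 (IH (n ⊔ w) (p≤q⇒p≤q⊔r w lo≤n) (⊔-lub n≤hi w≤hi))
                                                        (IH n lo≤n n≤hi) ⟩
  EmaxFrom n ((r , w) ∷ B ++ Ys)  ≡⟨ sym (EmaxFrom-++-∷ n B (r , w) Ys) ⟩
  EmaxFrom n (B ++ (r , w) ∷ Ys)  ∎
  where
  open ≤-Reasoning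
  IH : DominatedOn _ _ (A ++ Ys) (B ++ Ys)
  IH = dominatedOn-++ʳ A B Ys wf-Ys Ys≤hi A≼B

dominatedAt⇒dominatedOn : ∀ {lo p x q y} (Xs : List WBern) → 0ℚ ≤ q → q ≤ 1ℚ → All IsWB Xs →
  lo ≤ y → y ≤ x →
  EmaxFrom lo ((q , y) ∷ Xs) ≤ EmaxFrom lo ((p , x) ∷ Xs) →
  DominatedOn lo y ((q , y) ∷ Xs) ((p , x) ∷ Xs)
dominatedAt⇒dominatedOn {lo} {p} {x} {q} {y} Xs 0≤q q≤1 wf-Xs lo≤y y≤x hyp n lo≤n n≤y = begin
  EmaxFrom n ((q , y) ∷ Xs) ≡⟨ EmaxFrom-∷-≤ q Xs n≤y ⟩
  mix q (f y) (f n)         ≤⟨ mix-≤-raise-fallback {p = p} 0≤q q≤1 (f-mono lo≤n) (f-mono n≤x) (f-mono y≤x) hyp′ ⟩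
  mix p (f x) (f n)         ≡⟨ sym (EmaxFrom-∷-≤ p Xs n≤x) ⟩
  EmaxFrom n ((p , x) ∷ Xs) ∎
  where
  open ≤-Reasoning
  f : ℚ → ℚ
  f a = EmaxFrom a Xs
  f-mono : ∀ {a b} → a ≤ b → f a ≤ f b
  f-mono = EmaxFrom-mono-≤ Xs wf-Xs
  n≤x : n ≤ x
  n≤x = ≤-trans n≤y y≤x
  hyp′ : mix q (f y) (f lo) ≤ mix p (f x) (f lo)
  hyp′ = subst₂ _≤_ (EmaxFrom-∷-≤ q Xs lo≤y) (EmaxFrom-∷-≤ p Xs (≤-trans lo≤y y≤x)) hyp

lemma4p5 : (p x q y : ℚ) (Xs Ys : List WBern) →
    IsWB (p , x) → IsWB (q , y) → All IsWB Xs → All IsWB Ys →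
    y ≤ x → All (λ b → proj₂ b ≤ y) Ys →
    Emax ((p , x) ∷ Xs) ≥ Emax ((q , y) ∷ Xs) →
    Emax ((p , x) ∷ (Xs ++ Ys)) ≥ Emax ((q , y) ∷ (Xs ++ Ys))
lemma4p5 p x q y Xs Ys _ (0≤q , q≤1 , 0≤y) wf-Xs wf-Ys y≤x Ys≤y hyp =
  dominatedOn-++ʳ ((q , y) ∷ Xs) ((p , x) ∷ Xs) Ys wf-Ys Ys≤y
    (dominatedAt⇒dominatedOn {p = p} Xs 0≤q q≤1 wf-Xs 0≤y y≤x hyp)
    0ℚ (≤-refl {0ℚ}) 0≤y
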